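{- Let $G$ be a group and $A = \{a_1,\dots,a_n\} \subseteq G$ with $|A| = n$. Then the difference graph $D_A$ contains no connected component, other than the one consisting of the diagonal vertices $\{(i,i) : i \in [n]\}$, with more than $n$ vertices.
   Context: For a finite subset $A = \{a_1,\dots,a_n\}$ of a group $G$ (with distinct $a_i$), the difference graph $D_A$ has vertex set $[n] \times [n]$, where $[n] = \{1,\dots,n\}$, and two vertices $(i,j)$ and $(k,\ell)$ are joined by an edge precisely when $a_i a_j^{ -1} = a_k a_\ell^{ -1}$. -}

module Defs where

open import Level using (_⊔_)
open import Algebra.Bundles using (Group)
open import Data.Nat using (ℕ)
open import Data.Fin using (Fin)
open import Data.Product using (_×_; _,_)
open import Relation.Binary.PropositionalEquality using (_≡_)
open import Relation.Binary.Construct.Closure.ReflexiveTransitive using (Star)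

Vertex : ℕ → Set
Vertex n = Fin n × Fin n

module DifferenceGraph {c ℓ} (G : Group c ℓ) where
  open Group G

  -- The n elements a_1,…,a_n are pairwise distinct (so |A| = n).
  Distinct : {n : ℕ} → (Fin n → Carrier) → Set ℓ
  Distinct {n} a = (i j : Fin n) → a i ≈ a j → i ≡ j

  Edge : {n : ℕ} → (Fin n → Carrier) → Vertex n → Vertex n → Set ℓ
  Edge a (i , j) (k , l) = (a i ∙ a j ⁻¹) ≈ (a k ∙ a l ⁻¹)

  Connected : {n : ℕ} → (Fin n → Carrier) → Vertex n → Vertex n → Set ℓ
  Connected a = Star (Edge a)

-- Every edge preserves the difference a_i a_j⁻¹, so a connected component lies
-- in a single fibre {(i , j) : a_i a_j⁻¹ = g}. Within a fibre the row i
-- determines a_j, hence j, so projecting to the row is injective on the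
-- component; by pigeonhole it has at most n vertices.
module Submission where

open import Defs
open import Level using (Level)
open import Algebra.Bundles using (Group)
open import Data.Nat using (ℕ; suc)
open import Data.Nat.Properties using (n<1+n)
open import Data.Fin using (Fin)
open import Data.Fin.Properties using (<⇒notInjective)
open import Data.Product using (Σ; _×_; _,_; proj₁)
open import Function using (_∘_)
open import Relation.Nullary using (¬_)
open import Relation.Binary.PropositionalEquality using (_≡_; refl; cong)
open import Function.Definitions using (Injective)
open import Relation.Binary.Construct.Closure.ReflexiveTransitive using (gfold)
import Algebra.Properties.Group as GroupProperties

module _ {c ℓ : Level} (G : Group c ℓ) where
  open Group G renaming (refl to ≈-refl)
  open GroupProperties G using (∙-cancelˡ; ⁻¹-injective)
  open DifferenceGraph G

  difference : {n : ℕ} → (Fin n → Carrier) → Vertex n → Carrier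
  difference a (i , j) = a i ∙ a j ⁻¹

  connected⇒difference-≈ : {n : ℕ} (a : Fin n → Carrier) {v w : Vertex n} →
                           Connected a v w → difference a v ≈ difference a w
  connected⇒difference-≈ a = gfold (difference a) _≈_ trans ≈-refl

  difference-injectiveʳ : {n : ℕ} (a : Fin n → Carrier) → Distinct a →
                          ∀ i {j k} → a i ∙ a j ⁻¹ ≈ a i ∙ a k ⁻¹ → j ≡ k
  difference-injectiveʳ a distinct i {j} {k} eq =
    distinct j k (⁻¹-injective (∙-cancelˡ (a i) (a j ⁻¹) (a k ⁻¹) eq))

  row-injective-on-fibre : {n : ℕ} (a : Fin n → Carrier) → Distinct a →
                           {x y : Vertex n} → difference a x ≈ difference a y →
                           proj₁ x ≡ proj₁ y → x ≡ y
  row-injective-on-fibre a distinct {i , j} {.i , k} eq refl =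
    cong (i ,_) (difference-injectiveʳ a distinct i eq)

  row-injective-on-component : {n : ℕ} (a : Fin n → Carrier) → Distinct a →
                               {v x y : Vertex n} → Connected a v x → Connected a v y →
                               proj₁ x ≡ proj₁ y → x ≡ y
  row-injective-on-component a distinct v↝x v↝y =
    row-injective-on-fibre a distinct
      (trans (sym (connected⇒difference-≈ a v↝x)) (connected⇒difference-≈ a v↝y))

lemma2p8 : {c ℓ : Level} (G : Group c ℓ) (n : ℕ) (a : Fin n → Group.Carrier G)
    → DifferenceGraph.Distinct G a
    → (v : Vertex n)
    → ((i : Fin n) → ¬ DifferenceGraph.Connected G a v (i , i))
    → ¬ (Σ (Fin (suc n) → Vertex n) λ f
           → Injective _≡_ _≡_ f × ((k : Fin (suc n)) → DifferenceGraph.Connected G a v (f k)))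
lemma2p8 G n a distinct v _ (f , f-injective , f-connected) =
  <⇒notInjective (n<1+n n)
    (f-injective ∘ row-injective-on-component G a distinct (f-connected _) (f-connected _))
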